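{- A weighted game $v$ on $n$ voters has a realization $(q:\mathbf w)$ with $\mathbf w$ a vertex $p_j$ of $\Delta_n$ only if $v$ is a symmetric game. More precisely, for each $j\in\{1,\dots,n\}$ and each $m\in\{1,\dots,j\}$, the points $(q:p_j)$ with $q\in\left(\frac{m-1}{j},\frac{m}{j}\right]$ are exactly the realizations above $p_j$ of the game $\langle (n-j+m)(n-j+m-1)\cdots(n-j+1)\rangle$, whose winning coalitions are the coalitions containing at least $m$ of the voters $n-j+1,\dots,n$; thus exactly these $j$ symmetric games lie above $p_j$.
   Context: Let $N=\{1,\dots,n\}$. A simple game is a family $W$ of subsets of $N$ (winning coalitions) with $N\in W$, $\emptyset\notin W$, closed under supersets. A weighted game is a simple game $v$ admitting a realization $(q:\mathbf w)$: $\mathbf w=(w_n,\dots,w_1)\in\Delta_n:=\{w_n\ge\dots\ge w_1\ge0,\ \sum_i w_i=1\}$, $q\in(0,1]$, with $A$ winning iff $\sum_{i\in A}w_i\ge q$. The vertices of $\Delta_n$ are $p_1,\dots,p_n$, where $p_j$ has $w_n=\dots=w_{n-j+1}=1/j$ and all other coordinates $0$. A dummy is a voter in no minimal winning coalition; a game is symmetric if there is $k$ such that its winning coalitions are exactly those containing at least $k$ of its non-dummy voters. For a coalition $A$, $\langle A\rangle$ denotes the game whose winning coalitions are those $B$ with $B\ge A$, where for $A=\{a_1>\dots>a_k\}$, $B=\{b_1>\dots>b_l\}$, $B\ge A$ iff $k\le l$ and $b_i\ge a_i$ for $i\le k$.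
   Formalization: The quota q of the points $(q:p_j)$ ranges over the rationals in (0,1] rather than the reals. -}

module Defs where

open import Data.Nat as ℕ using (ℕ; zero; suc; _∸_; _≤ᵇ_; _<ᵇ_)
open import Data.Bool using (Bool; true; false; if_then_else_; _∧_)
open import Data.Fin as Fin using (Fin; toℕ)
open import Data.Fin.Subset using (Subset; _∈_; _∉_; _⊂_; _∩_; ∣_∣)
open import Data.Vec using (Vec; []; _∷_; tabulate)
open import Data.List using (List; []; _∷_; _++_)
open import Data.Product using (Σ; ∃; _×_; _,_)
open import Data.Unit using (⊤)
open import Data.Empty using (⊥)
open import Data.Integer using (+_)
open import Data.Rational using (ℚ; _/_; 0ℚ; _≤_) renaming (_+_ to _+ℚ_)
open import Relation.Nullary using (¬_)
open import Function.Bundles using (_⇔_)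

-- Voters are 1..n; voter v is represented by the index (v - 1) : Fin n.
-- A coalition is a Subset n.  A "game" is given by its predicate of winning coalitions.
Game : ℕ → Set₁
Game n = Subset n → Set

SameGame : ∀ {n} → Game n → Game n → Set
SameGame {n} v w = (A : Subset n) → v A ⇔ w A

sumOver : ∀ {n} → Subset n → (Fin n → ℚ) → ℚ
sumOver [] w = 0ℚ
sumOver (true ∷ A) w = w Fin.zero +ℚ sumOver A (λ i → w (Fin.suc i))
sumOver (false ∷ A) w = sumOver A (λ i → w (Fin.suc i))

WGame : ∀ {n} → ℚ → (Fin n → ℚ) → Game n
WGame q w A = q ≤ sumOver A w

-- the vertex p_j of Δ_n: voters n-j+1,...,n (indices ≥ n-j) get 1/j, others 0
pj : (n j : ℕ) → .{{_ : ℕ.NonZero j}} → Fin n → ℚ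
pj n j i = if (n ∸ j) ≤ᵇ toℕ i then (+ 1 / j) else 0ℚ


descListFrom : ∀ {n} → ℕ → Subset n → List ℕ
descListFrom k [] = []
descListFrom k (true ∷ A) = descListFrom (suc k) A ++ (suc k ∷ [])
descListFrom k (false ∷ A) = descListFrom (suc k) A

-- members of A as voter numbers 1..n listed in decreasing order
members↓ : ∀ {n} → Subset n → List ℕ
members↓ = descListFrom 0

_≽_ : List ℕ → List ℕ → Set
b ≽ [] = ⊤
[] ≽ (a ∷ as) = ⊥
(b ∷ bs) ≽ (a ∷ as) = (a ℕ.≤ b) × (bs ≽ as)

⟨_⟩ : ∀ {n} → Subset n → Game n
⟨ A ⟩ B = members↓ B ≽ members↓ A

segment : (n j m : ℕ) → Subset n
segment n j m = tabulate (λ i → ((n ∸ j) ≤ᵇ toℕ i) ∧ (toℕ i <ᵇ (n ∸ j) ℕ.+ m))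

top : (n j : ℕ) → Subset n
top n j = tabulate (λ i → (n ∸ j) ≤ᵇ toℕ i)

MinimalWinning : ∀ {n} → Game n → Subset n → Set
MinimalWinning v A = v A × (∀ B → B ⊂ A → ¬ v B)

Dummy : ∀ {n} → Game n → Fin n → Set
Dummy v i = ∀ A → MinimalWinning v A → i ∉ A

Symmetric : ∀ {n} → Game n → Set
Symmetric {n} v = Σ (Subset n) λ D → ((i : Fin n) → (i ∈ D ⇔ (¬ Dummy v i))) ×
                  Σ ℕ λ k → (A : Subset n) → v A ⇔ (k ℕ.≤ ∣ A ∩ D ∣)

-- Under p_j a coalition B weighs ∣ B ∩ top ∣ / j, so (q : p_j) is the quota game "at least m of
-- the top j voters" with m = ⌈q j⌉. Since B ≥ (n-j+m, …, n-j+1) says exactly that B has at least m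
-- members above n - j, this quota game is ⟨segment n j m⟩. In a quota game on S every voter outside
-- S is a dummy, while every voter of S lies in a window of m consecutive voters of S, a minimal
-- winning coalition; hence the game is symmetric.
module Submission where

open import Defs

module Combinatorics where
  open import Data.Bool using (Bool; true; false; T; _∧_; if_then_else_)
  open import Data.Bool.Properties using (T-≡; T-∧)
  open import Data.Empty using (⊥-elim)
  open import Data.Fin using (Fin; toℕ)
  open import Data.Fin.Properties using (toℕ<n)
  open import Data.Fin.Subset using (Subset; _∈_; _∉_; _⊆_; _⊂_; _∩_; _-_; ∣_∣)
  open import Data.Fin.Subset.Properties
    using (_∈?_; x∈p∩q⁺; x∈p∩q⁻; p⊆q⇒∣p∣≤∣q∣; p⊂q⇒∣p∣<∣q∣; x∈p⇒p-x⊂p; x∈p∧x≢y⇒x∈p-y)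
  open import Data.List using (List; []; _∷_; _++_)
  open import Data.List.Properties using (++-assoc; ++-identityʳ)
  open import Data.Nat
  open import Data.Nat.Properties
  open import Data.Product using (∃-syntax; _×_; _,_; proj₁)
  open import Data.Unit using (⊤; tt)
  open import Data.Vec using ([]; _∷_; tabulate)
  open import Data.Vec.Properties using (lookup∘tabulate; lookup⇒[]=; []=⇒lookup; tabulate-cong)
  open import Function.Bundles using (_⇔_; mk⇔; Equivalence)
  open import Relation.Binary.PropositionalEquality
  open import Relation.Nullary using (¬_; yes; no)
  open import Relation.Unary using (Decidable)

  open Equivalence

  ¬T⇒≡false : ∀ {b} → ¬ T b → b ≡ false
  ¬T⇒≡false {false} _ = refl
  ¬T⇒≡false {true} ¬t = ⊥-elim (¬t tt)

  ≤ᵇ≡<ᵇsuc : ∀ a x → (a ≤ᵇ x) ≡ (a <ᵇ suc x)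
  ≤ᵇ≡<ᵇsuc zero x = refl
  ≤ᵇ≡<ᵇsuc (suc a) x = refl

  <⇒<ᵇ≡true : ∀ {a x} → a < x → (a <ᵇ x) ≡ true
  <⇒<ᵇ≡true a<x = to T-≡ (<⇒<ᵇ a<x)

  ≤⇒<ᵇ≡false : ∀ {a x} → x ≤ a → (a <ᵇ x) ≡ false
  ≤⇒<ᵇ≡false {a} {x} x≤a = ¬T⇒≡false (λ t → <⇒≱ (<ᵇ⇒< a x t) x≤a)

  indicator : ∀ n → (ℕ → Bool) → Subset n
  indicator n g = tabulate (λ i → g (toℕ i))

  ∈-indicator : ∀ {n} (g : ℕ → Bool) {i : Fin n} → i ∈ indicator n g ⇔ T (g (toℕ i))
  ∈-indicator g {i} = mk⇔
    (λ i∈ → from T-≡ (trans (sym (lookup∘tabulate (λ i → g (toℕ i)) i)) ([]=⇒lookup i∈)))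
    (λ t → lookup⇒[]= i _ (trans (lookup∘tabulate (λ i → g (toℕ i)) i) (to T-≡ t)))

  window : ℕ → ℕ → ℕ → Bool
  window a m x = (a ≤ᵇ x) ∧ (x <ᵇ a + m)

  T-window : ∀ {a m x} → T (window a m x) ⇔ (a ≤ x × x < a + m)
  T-window {a} {m} {x} = mk⇔
    (λ t → let (a≤ᵇx , x<ᵇa+m) = to T-∧ t in ≤ᵇ⇒≤ a x a≤ᵇx , <ᵇ⇒< x (a + m) x<ᵇa+m)
    (λ (a≤x , x<a+m) → from T-∧ (≤⇒≤ᵇ a≤x , <⇒<ᵇ x<a+m))

  window-suc : ∀ a m x → window (suc a) m (suc x) ≡ window a m x
  window-suc a m x = cong (_∧ (x <ᵇ a + m)) (sym (≤ᵇ≡<ᵇsuc a x))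

  interval↓ : ℕ → ℕ → List ℕ
  interval↓ a zero = []
  interval↓ a (suc m) = suc (a + m) ∷ interval↓ a m

  interval↓-∷ʳ : ∀ a m → interval↓ (suc a) m ++ suc a ∷ [] ≡ interval↓ a (suc m)
  interval↓-∷ʳ a zero = cong (λ x → suc x ∷ []) (sym (+-identityʳ a))
  interval↓-∷ʳ a (suc m) = cong₂ _∷_ (cong suc (sym (+-suc a m))) (interval↓-∷ʳ a m)

  -- The window is measured from the offset k, so the recursion shifts the window (window-suc) rather
  -- than the offset.
  descListFrom-window : ∀ {n} k r m → r + m ≤ n →
                        descListFrom k (indicator n (window r m)) ≡ interval↓ (r + k) m
  descListFrom-window {zero} k zero zero _ = refl
  descListFrom-window {suc n} k zero zero _ = descListFrom-window {n} (suc k) zero zero z≤n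
  descListFrom-window {suc n} k zero (suc m) (s≤s m≤n) =
    trans (cong (_++ suc k ∷ []) (descListFrom-window {n} (suc k) zero m m≤n)) (interval↓-∷ʳ k m)
  descListFrom-window {suc n} k (suc r) m (s≤s r+m≤n) = begin
    descListFrom (suc k) (indicator n (λ x → window (suc r) m (suc x)))
      ≡⟨ cong (descListFrom {n} (suc k)) (tabulate-cong (λ i → window-suc r m (toℕ i))) ⟩
    descListFrom (suc k) (indicator n (window r m))
      ≡⟨ descListFrom-window {n} (suc k) r m r+m≤n ⟩
    interval↓ (r + suc k) m
      ≡⟨ cong (λ a → interval↓ a m) (+-suc r k) ⟩
    interval↓ (suc r + k) m ∎
    where open ≡-Reasoning

  members↓-window : ∀ {n} a m → a + m ≤ n → members↓ (indicator n (window a m)) ≡ interval↓ a m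
  members↓-window {n} a m a+m≤n =
    trans (descListFrom-window {n} 0 a m a+m≤n) (cong (λ x → interval↓ x m) (+-identityʳ a))

  Descending : ℕ → List ℕ → Set
  Descending u [] = ⊤
  Descending u (x ∷ xs) = x < u × Descending x xs

  Descending-weaken : ∀ {u u′} xs → u ≤ u′ → Descending u xs → Descending u′ xs
  Descending-weaken [] _ _ = tt
  Descending-weaken (x ∷ xs) u≤u′ (x<u , desc) = <-≤-trans x<u u≤u′ , desc

  descListFrom-++-descending : ∀ {n} k (A : Subset n) s → Descending (suc k) s →
                               Descending (suc (n + k)) (descListFrom k A ++ s)
  descListFrom-++-descending k [] s desc = desc
  descListFrom-++-descending {suc n} k (false ∷ A) s desc =
    Descending-weaken (descListFrom (suc k) A ++ s) (≤-reflexive (cong suc (+-suc n k)))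
      (descListFrom-++-descending (suc k) A s (Descending-weaken s (n≤1+n _) desc))
  descListFrom-++-descending {suc n} k (true ∷ A) s desc
    rewrite ++-assoc (descListFrom (suc k) A) (suc k ∷ []) s =
    Descending-weaken (descListFrom (suc k) A ++ suc k ∷ s) (≤-reflexive (cong suc (+-suc n k)))
      (descListFrom-++-descending (suc k) A (suc k ∷ s) (≤-refl , desc))

  members↓-descending : ∀ {n} (A : Subset n) → Descending (suc n) (members↓ A)
  members↓-descending {n} A =
    subst (Descending (suc n)) (++-identityʳ (members↓ A))
      (Descending-weaken (members↓ A ++ []) (≤-reflexive (cong suc (+-identityʳ n)))
        (descListFrom-++-descending 0 A [] tt))

  countAbove : ℕ → List ℕ → ℕ
  countAbove t [] = 0
  countAbove t (x ∷ xs) = if t <ᵇ x then suc (countAbove t xs) else countAbove t xs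

  private
    shift-offset : ∀ t k {g : ℕ → Bool} → (∀ x → g x ≡ (t <ᵇ suc (x + k))) →
            ∀ x → g (suc x) ≡ (t <ᵇ suc (x + suc k))
    shift-offset t k g≗ x = trans (g≗ (suc x)) (cong (λ y → t <ᵇ suc y) (sym (+-suc x k)))

  countAbove-∷ʳ : ∀ t xs y → countAbove t (xs ++ y ∷ []) ≡ countAbove t (y ∷ xs)
  countAbove-∷ʳ t [] y = refl
  countAbove-∷ʳ t (x ∷ xs) y with t <ᵇ x | t <ᵇ y | countAbove-∷ʳ t xs y
  ... | true  | true  | eq = cong suc eq
  ... | true  | false | eq = cong suc eq
  ... | false | true  | eq = eq
  ... | false | false | eq = eq

  countAbove-descListFrom : ∀ {n} t k (A : Subset n) {g : ℕ → Bool} →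
                            (∀ x → g x ≡ (t <ᵇ suc (x + k))) →
                            countAbove t (descListFrom k A) ≡ ∣ A ∩ indicator n g ∣
  countAbove-descListFrom t k [] _ = refl
  countAbove-descListFrom t k (false ∷ A) g≗ = countAbove-descListFrom t (suc k) A (shift-offset t k g≗)
  countAbove-descListFrom t k (true ∷ A) g≗
    rewrite countAbove-∷ʳ t (descListFrom (suc k) A) (suc k) | g≗ 0
    with t <ᵇ suc k
  ... | true  = cong suc (countAbove-descListFrom t (suc k) A (shift-offset t k g≗))
  ... | false = countAbove-descListFrom t (suc k) A (shift-offset t k g≗)

  countAbove-members↓ : ∀ {n} t (A : Subset n) →
                        countAbove t (members↓ A) ≡ ∣ A ∩ indicator n (t ≤ᵇ_) ∣
  countAbove-members↓ t A =
    countAbove-descListFrom t 0 A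
      (λ x → trans (≤ᵇ≡<ᵇsuc t x) (cong (λ y → t <ᵇ suc y) (sym (+-identityʳ x))))

  countAbove-interval↓ : ∀ {t a} m → t ≤ a → countAbove t (interval↓ a m) ≡ m
  countAbove-interval↓ zero _ = refl
  countAbove-interval↓ {t} {a} (suc m) t≤a
    rewrite <⇒<ᵇ≡true {t} {suc (a + m)} (s≤s (≤-trans t≤a (m≤m+n a m))) =
    cong suc (countAbove-interval↓ m t≤a)

  countAbove-below : ∀ {u} t xs → Descending u xs → u ≤ suc t → countAbove t xs ≡ 0
  countAbove-below t [] _ _ = refl
  countAbove-below t (x ∷ xs) (x<u , desc) u≤1+t
    rewrite ≤⇒<ᵇ≡false {t} {x} (s≤s⁻¹ (≤-trans x<u u≤1+t)) =
    countAbove-below t xs desc (≤-trans (n≤1+n x) (≤-trans x<u u≤1+t))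

  countAbove-bound : ∀ {u} t xs → Descending u xs → t < u → countAbove t xs + t < u
  countAbove-bound t [] _ t<u = t<u
  countAbove-bound t (x ∷ xs) (x<u , desc) t<u with t <? x
  ... | yes t<x rewrite <⇒<ᵇ≡true t<x = <-≤-trans (s≤s (countAbove-bound t xs desc t<x)) x<u
  ... | no t≮x
    rewrite ≤⇒<ᵇ≡false (≮⇒≥ t≮x) | countAbove-below t xs desc (m≤n⇒m≤1+n (≮⇒≥ t≮x)) = t<u

  ≽-interval↓⇔ : ∀ {u} t m xs → Descending u xs → xs ≽ interval↓ t m ⇔ m ≤ countAbove t xs
  ≽-interval↓⇔ t m xs desc = mk⇔ (≽⇒≤ m xs) (≤⇒≽ m xs desc)
    where
    ≽⇒≤ : ∀ m xs → xs ≽ interval↓ t m → m ≤ countAbove t xs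
    ≽⇒≤ zero xs _ = z≤n
    ≽⇒≤ (suc m) (x ∷ xs) (t+m<x , xs≽)
      rewrite <⇒<ᵇ≡true {t} {x} (≤-trans (s≤s (m≤m+n t m)) t+m<x) = s≤s (≽⇒≤ m xs xs≽)
    ≤⇒≽ : ∀ {u} m xs → Descending u xs → m ≤ countAbove t xs → xs ≽ interval↓ t m
    ≤⇒≽ zero xs _ _ = tt
    ≤⇒≽ (suc m) (x ∷ xs) (x<u , desc) m<c with t <? x
    ... | yes t<x rewrite <⇒<ᵇ≡true t<x =
      ≤-<-trans (≤-trans (+-monoʳ-≤ t (s≤s⁻¹ m<c)) (≤-reflexive (+-comm t _)))
                (countAbove-bound t xs desc t<x) ,
      ≤⇒≽ m xs desc (s≤s⁻¹ m<c)
    ... | no t≮x rewrite ≤⇒<ᵇ≡false (≮⇒≥ t≮x) | countAbove-below t xs desc (m≤n⇒m≤1+n (≮⇒≥ t≮x)) =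
      ⊥-elim (≤⇒≯ z≤n m<c)

  Quota : ∀ {n} → ℕ → Subset n → Game n
  Quota m S B = m ≤ ∣ B ∩ S ∣

  ⟨window⟩≈Quota : ∀ {n} a m → a + m ≤ n →
                   SameGame ⟨ indicator n (window a m) ⟩ (Quota m (indicator n (a ≤ᵇ_)))
  ⟨window⟩≈Quota a m a+m≤n B =
    subst₂ (λ ys c → members↓ B ≽ ys ⇔ m ≤ c) (sym (members↓-window a m a+m≤n)) (countAbove-members↓ a B)
      (≽-interval↓⇔ a m (members↓ B) (members↓-descending B))

  ∣window∩indicator∣ : ∀ {n t a} m → t ≤ a → a + m ≤ n →
                       ∣ indicator n (window a m) ∩ indicator n (t ≤ᵇ_) ∣ ≡ m
  ∣window∩indicator∣ {n} {t} {a} m t≤a a+m≤n = begin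
    ∣ W ∩ indicator n (t ≤ᵇ_) ∣    ≡⟨ sym (countAbove-members↓ t W) ⟩
    countAbove t (members↓ W)      ≡⟨ cong (countAbove t) (members↓-window a m a+m≤n) ⟩
    countAbove t (interval↓ a m)   ≡⟨ countAbove-interval↓ m t≤a ⟩
    m                              ∎
    where
    open ≡-Reasoning
    W : Subset n
    W = indicator n (window a m)

  window⊆indicator : ∀ {n t a} m → t ≤ a → indicator n (window a m) ⊆ indicator n (t ≤ᵇ_)
  window⊆indicator {t = t} {a} m t≤a x∈ =
    from (∈-indicator (t ≤ᵇ_))
      (≤⇒≤ᵇ (≤-trans t≤a (proj₁ (to T-window (to (∈-indicator (window a m)) x∈)))))

  window-around : ∀ {t m n x} → 1 ≤ m → t + m ≤ n → t ≤ x → x < n →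
                  ∃[ a ] (t ≤ a × a + m ≤ n × a ≤ x × x < a + m)
  window-around {t} {m} {n} {x} 1≤m t+m≤n t≤x x<n with x + m ≤? n
  ... | yes x+m≤n = x , t≤x , x+m≤n , ≤-refl , m<m+n x 1≤m
  ... | no x+m≰n = n ∸ m , m+n≤o⇒m≤o∸n t t+m≤n , ≤-reflexive (m∸n+n≡m m≤n) ,
                   m≤n+o⇒m∸n≤o n m (≤-trans (<⇒≤ (≰⇒> x+m≰n)) (≤-reflexive (+-comm x m))) ,
                   subst (x <_) (sym (m∸n+n≡m m≤n)) x<n
    where m≤n = m+n≤o⇒n≤o t t+m≤n

  quota-minimalWinning : ∀ {n m} {S W : Subset n} {v : Game n} → SameGame v (Quota m S) →
                         W ⊆ S → ∣ W ∩ S ∣ ≡ m → MinimalWinning v W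
  quota-minimalWinning {S = S} {W} v≈ W⊆S ∣W∩S∣≡m =
    from (v≈ W) (≤-reflexive (sym ∣W∩S∣≡m)) ,
    λ B B⊂W vB → <⇒≱ (subst (∣ B ∩ S ∣ <_) ∣W∩S∣≡m (p⊂q⇒∣p∣<∣q∣ (∩-⊂ B⊂W))) (to (v≈ B) vB)
    where
    ∩-⊂ : ∀ {B} → B ⊂ W → B ∩ S ⊂ W ∩ S
    ∩-⊂ {B} (B⊆W , x , x∈W , x∉B) =
      (λ y∈ → let (y∈B , y∈S) = x∈p∩q⁻ B S y∈ in x∈p∩q⁺ (B⊆W y∈B , y∈S)) ,
      x , x∈p∩q⁺ (x∈W , W⊆S x∈W) , λ x∈ → x∉B (proj₁ (x∈p∩q⁻ B S x∈))

  quota-dummy : ∀ {n m} {S : Subset n} {v : Game n} {i} → SameGame v (Quota m S) → i ∉ S → Dummy v i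
  quota-dummy {S = S} {v} {i} v≈ i∉S A (vA , minimal) i∈A =
    minimal (A - i) (x∈p⇒p-x⊂p i∈A) (from (v≈ (A - i)) (≤-trans (to (v≈ A) vA) (p⊆q⇒∣p∣≤∣q∣ ∩⊆)))
    where
    ∩⊆ : A ∩ S ⊆ (A - i) ∩ S
    ∩⊆ y∈ = let (y∈A , y∈S) = x∈p∩q⁻ A S y∈ in
            x∈p∩q⁺ (x∈p∧x≢y⇒x∈p-y y∈A (λ { refl → i∉S y∈S }) , y∈S)

  quota-symmetric : ∀ {n m} {S : Subset n} {v : Game n} → SameGame v (Quota m S) →
                    (∀ i → i ∈ S → ∃[ W ] (W ⊆ S × ∣ W ∩ S ∣ ≡ m × i ∈ W)) → Symmetric v
  quota-symmetric {m = m} {S} {v} v≈ cover = S , (λ i → mk⇔ (nonDummy i) (member i)) , m , v≈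
    where
    nonDummy : ∀ i → i ∈ S → ¬ Dummy v i
    nonDummy i i∈S dummy =
      let (W , W⊆S , ∣W∩S∣≡m , i∈W) = cover i i∈S in
      dummy W (quota-minimalWinning v≈ W⊆S ∣W∩S∣≡m) i∈W
    member : ∀ i → ¬ Dummy v i → i ∈ S
    member i ¬dummy with i ∈? S
    ... | yes i∈S = i∈S
    ... | no i∉S = ⊥-elim (¬dummy (quota-dummy v≈ i∉S))

  indicator-quota-symmetric : ∀ {n t m} {v : Game n} → 1 ≤ m → t + m ≤ n →
                              SameGame v (Quota m (indicator n (t ≤ᵇ_))) → Symmetric v
  indicator-quota-symmetric {n} {t} {m} 1≤m t+m≤n v≈ = quota-symmetric v≈ cover
    where
    S = indicator n (t ≤ᵇ_)
    cover : ∀ i → i ∈ S → ∃[ W ] (W ⊆ S × ∣ W ∩ S ∣ ≡ m × i ∈ W)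
    cover i i∈ =
      let t≤i = ≤ᵇ⇒≤ t _ (to (∈-indicator (t ≤ᵇ_)) i∈)
          (a , t≤a , a+m≤n , a≤i , i<a+m) = window-around 1≤m t+m≤n t≤i (toℕ<n i) in
      indicator n (window a m) , window⊆indicator m t≤a , ∣window∩indicator∣ m t≤a a+m≤n ,
      from (∈-indicator (window a m)) (from T-window (a≤i , i<a+m))

  crossing : (P : ℕ → Set) → Decidable P → ¬ P 0 → ∀ j → P j →
             ∃[ m ] (1 ≤ m × m ≤ j × ¬ P (m ∸ 1) × P m)
  crossing P P? ¬P0 zero P0 = ⊥-elim (¬P0 P0)
  crossing P P? ¬P0 (suc j) P[1+j] with P? j
  ... | yes Pj = let (m , 1≤m , m≤j , ¬P[m-1] , Pm) = crossing P P? ¬P0 j Pj in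
                 m , 1≤m , m≤n⇒m≤1+n m≤j , ¬P[m-1] , Pm
  ... | no ¬Pj = suc j , s≤s z≤n , ≤-refl , ¬Pj , P[1+j]

open Combinatorics
open import Data.Bool using (Bool; true; false; if_then_else_)
open import Data.Empty using (⊥-elim)
open import Data.Fin using (toℕ)
open import Data.Fin.Subset using (Subset; _∩_; ∣_∣)
open import Data.Integer as ℤ using (+_)
import Data.Integer.Properties as ℤ
open import Data.Nat as ℕ using (ℕ; NonZero; _∸_; suc; _≤ᵇ_)
import Data.Nat.Properties as ℕ
open import Data.Product using (Σ; _×_; _,_)
open import Data.Vec using ([]; _∷_)
open import Data.Rational using (ℚ; _/_; 0ℚ; 1ℚ; _<_; _≤_; _+_; toℚᵘ; fromℚᵘ)
import Data.Rational.Properties as ℚ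
import Data.Rational.Unnormalised as ℚᵘ
import Data.Rational.Unnormalised.Properties as ℚᵘ
open import Function using (_∘_)
open import Function.Bundles using (_⇔_; mk⇔; Equivalence)
open import Function.Construct.Composition using (_⇔-∘_)
open import Function.Construct.Symmetry using (⇔-sym)
open import Relation.Binary.PropositionalEquality
open import Relation.Nullary using (¬_; yes; no)

open Equivalence

n/n≡1 : ∀ n .{{_ : NonZero n}} → + n / n ≡ 1ℚ
n/n≡1 (suc d) = ℚ.fromℚᵘ-cong {ℚᵘ.mkℚᵘ (+ suc d) d} {ℚᵘ.mkℚᵘ (+ 1) 0} (ℚᵘ.*≡* (ℤ.*-comm (+ suc d) (+ 1)))

/-monoˡ-≤ : ∀ {a b} n .{{_ : NonZero n}} → a ℕ.≤ b → + a / n ≤ + b / n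
/-monoˡ-≤ {a} {b} (suc d) a≤b =
  ℚ.toℚᵘ-cancel-≤ (ℚᵘ.≤-respˡ-≃ (ℚᵘ.≃-sym (ℚ.toℚᵘ-fromℚᵘ (ℚᵘ.mkℚᵘ (+ a) d)))
                    (ℚᵘ.≤-respʳ-≃ (ℚᵘ.≃-sym (ℚ.toℚᵘ-fromℚᵘ (ℚᵘ.mkℚᵘ (+ b) d)))
                      (ℚᵘ.*≤* (ℤ.*-monoʳ-≤-nonNeg (+ suc d) (ℤ.+≤+ a≤b)))))

/-+ : ∀ a b n .{{_ : NonZero n}} → + a / n + + b / n ≡ + (a ℕ.+ b) / n
/-+ a b (suc d) = begin
  x + y                                   ≡⟨ sym (ℚ.fromℚᵘ-toℚᵘ (x + y)) ⟩
  fromℚᵘ (toℚᵘ (x + y))                   ≡⟨ ℚ.fromℚᵘ-cong sum≃ ⟩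
  fromℚᵘ (ℚᵘ.mkℚᵘ (+ (a ℕ.+ b)) d)       ∎
  where
  open ≡-Reasoning
  j = + suc d
  x = + a / suc d
  y = + b / suc d
  cross : (+ a ℤ.* j ℤ.+ + b ℤ.* j) ℤ.* j ≡ + (a ℕ.+ b) ℤ.* (j ℤ.* j)
  cross = begin
    (+ a ℤ.* j ℤ.+ + b ℤ.* j) ℤ.* j ≡⟨ cong (ℤ._* j) (sym (ℤ.*-distribʳ-+ j (+ a) (+ b))) ⟩
    ((+ a ℤ.+ + b) ℤ.* j) ℤ.* j     ≡⟨ ℤ.*-assoc (+ a ℤ.+ + b) j j ⟩
    (+ a ℤ.+ + b) ℤ.* (j ℤ.* j)     ≡⟨ cong (ℤ._* (j ℤ.* j)) (sym (ℤ.pos-+ a b)) ⟩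
    + (a ℕ.+ b) ℤ.* (j ℤ.* j)       ∎
  sum≃ : toℚᵘ (x + y) ℚᵘ.≃ ℚᵘ.mkℚᵘ (+ (a ℕ.+ b)) d
  sum≃ = ℚᵘ.≃-trans (ℚ.toℚᵘ-homo-+ x y)
           (ℚᵘ.≃-trans (ℚᵘ.+-cong (ℚ.toℚᵘ-fromℚᵘ (ℚᵘ.mkℚᵘ (+ a) d)) (ℚ.toℚᵘ-fromℚᵘ (ℚᵘ.mkℚᵘ (+ b) d)))
                       (ℚᵘ.*≡* cross))

sumOver-indicator : ∀ {n} j .{{_ : NonZero j}} (A : Subset n) (g : ℕ → Bool) →
                    sumOver A (λ i → if g (toℕ i) then + 1 / j else 0ℚ) ≡ + ∣ A ∩ indicator n g ∣ / j
sumOver-indicator j [] g = sym (ℚ.0/n≡0 j)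
sumOver-indicator j (false ∷ A) g = sumOver-indicator j A (λ x → g (suc x))
sumOver-indicator j (true ∷ A) g with g 0
... | true  = trans (cong (λ s → + 1 / j + s) (sumOver-indicator j A (λ x → g (suc x)))) (/-+ 1 _ j)
... | false = trans (ℚ.+-identityˡ _) (sumOver-indicator j A (λ x → g (suc x)))

sumOver-pj : ∀ n j .{{_ : NonZero j}} (B : Subset n) → sumOver B (pj n j) ≡ + ∣ B ∩ top n j ∣ / j
sumOver-pj n j B = sumOver-indicator j B ((n ∸ j) ≤ᵇ_)

threshold⇔ : ∀ {q m c} j .{{_ : NonZero j}} → + (m ∸ 1) / j < q → q ≤ + m / j → q ≤ + c / j ⇔ m ℕ.≤ c
threshold⇔ {q} {m} {c} j lower upper = mk⇔ reach (λ m≤c → ℚ.≤-trans upper (/-monoˡ-≤ j m≤c))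
  where
  reach : q ≤ + c / j → m ℕ.≤ c
  reach q≤c/j with m ℕ.≤? c
  ... | yes m≤c = m≤c
  ... | no m≰c = ⊥-elim (ℚ.<-irrefl refl
                   (ℚ.<-≤-trans lower (ℚ.≤-trans q≤c/j (/-monoˡ-≤ j (ℕ.∸-monoˡ-≤ 1 (ℕ.≰⇒> m≰c))))))

segment-fits : ∀ {n j m} → m ℕ.≤ j → j ℕ.≤ n → n ∸ j ℕ.+ m ℕ.≤ n
segment-fits {n} {j} m≤j j≤n = ℕ.≤-trans (ℕ.+-monoʳ-≤ (n ∸ j) m≤j) (ℕ.≤-reflexive (ℕ.m∸n+n≡m j≤n))

segment≈Quota : ∀ {n j m} → m ℕ.≤ j → j ℕ.≤ n → SameGame ⟨ segment n j m ⟩ (Quota m (top n j))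
segment≈Quota {n} {j} {m} m≤j j≤n = ⟨window⟩≈Quota (n ∸ j) m (segment-fits m≤j j≤n)

segment-count : ∀ {n j m} → m ℕ.≤ j → j ℕ.≤ n → ∣ segment n j m ∩ top n j ∣ ≡ m
segment-count {m = m} m≤j j≤n = ∣window∩indicator∣ m ℕ.≤-refl (segment-fits m≤j j≤n)

SameGame-respʳ : ∀ {n} {v w w′ : Game n} → SameGame w w′ → SameGame v w ⇔ SameGame v w′
SameGame-respʳ w≈w′ = mk⇔ (λ v≈w B → w≈w′ B ⇔-∘ v≈w B) (λ v≈w′ B → ⇔-sym (w≈w′ B) ⇔-∘ v≈w′ B)

pj≈Quota : ∀ {n q m} j .{{_ : NonZero j}} → + (m ∸ 1) / j < q → q ≤ + m / j →
           SameGame (WGame q (pj n j)) (Quota m (top n j))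
pj≈Quota {n} {q} {m} j lower upper B =
  subst (λ s → q ≤ s ⇔ m ℕ.≤ ∣ B ∩ top n j ∣) (sym (sumOver-pj n j B)) (threshold⇔ j lower upper)

-- The segments with m and m - 1 members weigh m / j and (m - 1) / j; the first wins, the second loses.
pj≈Quota⁻ : ∀ {n q m} j .{{_ : NonZero j}} → 1 ℕ.≤ m → m ℕ.≤ j → j ℕ.≤ n →
            SameGame (WGame q (pj n j)) (Quota m (top n j)) → + (m ∸ 1) / j < q × q ≤ + m / j
pj≈Quota⁻ {n} {q} {m} j 1≤m m≤j j≤n v≈ = ℚ.≰⇒> lower , upper
  where
  weight : ∀ {k} → k ℕ.≤ j → sumOver (segment n j k) (pj n j) ≡ + k / j
  weight {k} k≤j = trans (sumOver-pj n j (segment n j k)) (cong (λ c → + c / j) (segment-count k≤j j≤n))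
  upper : q ≤ + m / j
  upper = subst (q ≤_) (weight m≤j)
            (from (v≈ (segment n j m)) (ℕ.≤-reflexive (sym (segment-count m≤j j≤n))))
  lower : ¬ q ≤ + (m ∸ 1) / j
  lower q≤ = ℕ.<⇒≱ (ℕ.∸-monoʳ-< ℕ.z<s 1≤m)
               (subst (m ℕ.≤_) (segment-count m-1≤j j≤n)
                 (to (v≈ (segment n j (m ∸ 1))) (subst (q ≤_) (sym (weight m-1≤j)) q≤)))
    where
    m-1≤j : m ∸ 1 ℕ.≤ j
    m-1≤j = ℕ.≤-trans (ℕ.m∸n≤m m 1) m≤j

pj-realizes-segment⇔ : ∀ {n q m} j .{{_ : NonZero j}} → 1 ℕ.≤ m → m ℕ.≤ j → j ℕ.≤ n →
                       SameGame (WGame q (pj n j)) ⟨ segment n j m ⟩ ⇔ (+ (m ∸ 1) / j < q × q ≤ + m / j)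
pj-realizes-segment⇔ {n} {q} {m} j 1≤m m≤j j≤n =
  mk⇔ (pj≈Quota⁻ j 1≤m m≤j j≤n ∘ to segment≈)
      (λ (lower , upper) → from segment≈ (pj≈Quota j lower upper))
  where
  segment≈ : SameGame (WGame q (pj n j)) ⟨ segment n j m ⟩ ⇔ SameGame (WGame q (pj n j)) (Quota m (top n j))
  segment≈ = SameGame-respʳ (segment≈Quota m≤j j≤n)

quota-level : ∀ {q} j .{{_ : NonZero j}} → 0ℚ < q → q ≤ 1ℚ →
              Σ ℕ λ m → 1 ℕ.≤ m × m ℕ.≤ j × + (m ∸ 1) / j < q × q ≤ + m / j
quota-level {q} j 0<q q≤1 =
  let (m , 1≤m , m≤j , q≰[m-1]/j , q≤m/j) =
        crossing (λ k → q ≤ + k / j) (λ k → q ℚ.≤? + k / j) q≰0/j j q≤j/j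
  in m , 1≤m , m≤j , ℚ.≰⇒> q≰[m-1]/j , q≤m/j
  where
  q≰0/j : ¬ q ≤ + 0 / j
  q≰0/j q≤0/j = ℚ.<-irrefl refl (ℚ.<-≤-trans 0<q (subst (q ≤_) (ℚ.0/n≡0 j) q≤0/j))
  q≤j/j : q ≤ + j / j
  q≤j/j = subst (q ≤_) (sym (n/n≡1 j)) q≤1

corollary4p9 : (n j : ℕ) → .{{_ : NonZero j}} → j ℕ.≤ n →
    ((m : ℕ) → 1 ℕ.≤ m → m ℕ.≤ j →
      ((B : _) → ⟨ segment n j m ⟩ B ⇔ (m ℕ.≤ ∣ B ∩ top n j ∣)) ×
      ((q : ℚ) → 0ℚ < q → q ≤ 1ℚ →
        (SameGame (WGame q (pj n j)) ⟨ segment n j m ⟩ ⇔ ((+ (m ∸ 1) / j < q) × (q ≤ + m / j))))) ×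
    ((q : ℚ) → 0ℚ < q → q ≤ 1ℚ →
      Symmetric (WGame q (pj n j)) ×
      Σ ℕ (λ m → (1 ℕ.≤ m) × (m ℕ.≤ j) × SameGame (WGame q (pj n j)) ⟨ segment n j m ⟩))
corollary4p9 n j j≤n =
  (λ m 1≤m m≤j → segment≈Quota m≤j j≤n , λ q _ _ → pj-realizes-segment⇔ j 1≤m m≤j j≤n) ,
  λ q 0<q q≤1 →
    let (m , 1≤m , m≤j , lower , upper) = quota-level j 0<q q≤1
        pj≈ = pj≈Quota j lower upper
    in indicator-quota-symmetric 1≤m (segment-fits m≤j j≤n) pj≈ ,
       m , 1≤m , m≤j , from (SameGame-respʳ (segment≈Quota m≤j j≤n)) pj≈
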